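{- If the binary expansion of the positive integer $n$ is $(10)^\ell 11$ for some $\ell\ge2$ (i.e. $\ell$ copies of the block $10$ followed by $11$), then $s(n^2)\ge7$.
   Context: $s(n)$ is the sum of binary digits of $n$; binary words are written from most significant to least significant bit. -}

module Defs where

open import Data.Nat using (ℕ; zero; suc; _+_; _*_)
open import Data.Nat.DivMod using (_/_; _%_)
open import Data.Bool using (Bool; true; false)
open import Data.List using (List; []; _∷_; _++_; replicate; concat; foldl)

-- s(n): sum of the binary digits of n.
-- Computed by repeatedly taking n % 2 and n / 2; the fuel argument n is
-- always sufficient since n / 2 < n for n > 0 and we need at most n steps.
digitSumFuel : ℕ → ℕ → ℕ
digitSumFuel zero    _ = 0
digitSumFuel (suc k) m = m % 2 + digitSumFuel k (m / 2)

s : ℕ → ℕ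
s n = digitSumFuel n n

bitVal : Bool → ℕ
bitVal false = 0
bitVal true  = 1

value : List Bool → ℕ
value = foldl (λ acc b → 2 * acc + bitVal b) 0

word : ℕ → List Bool
word ℓ = concat (replicate ℓ (true ∷ false ∷ [])) ++ (true ∷ true ∷ [])

-- 3n = 2^(2ℓ+3) + 1, so with ℓ = m + 2 and 4^m = 3t + 1 we get n = 128t + 43
-- and n² = 2⁶(7·2^J + 4t(t+1)) + 57 with 2^J = 4(3t+1)² > 4t(t+1).  Binary
-- digit sums add over such non-overlapping blocks, so s(n²) = s 7 + s(4t(t+1)) + s 57 ≥ 3 + 4.
module Submission where

open import Defs
open import Data.Nat using (ℕ; _≤_; _*_)
open import Relation.Binary.PropositionalEquality using (_≡_)

open import Data.Nat using (zero; suc; _+_; _^_; _<_; z≤n; s≤s; _/_; _%_)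
open import Data.Nat.Properties
open import Data.Nat.DivMod
open import Data.Nat.Divisibility using (divides-refl)
open import Data.Nat.Tactic.RingSolver using (solve-∀)
open import Data.Bool using (Bool)
open import Data.List using ([]; _∷_; foldl; length)
open import Data.Product using (_×_; _,_; ∃; ∃₂)
open import Relation.Binary.PropositionalEquality
  using (refl; sym; trans; cong; cong₂; subst; module ≡-Reasoning)

digitSumFuel-zero : ∀ k → digitSumFuel k 0 ≡ 0
digitSumFuel-zero zero    = refl
digitSumFuel-zero (suc k) = digitSumFuel-zero k

digitSumFuel-fuel-irrelevant : ∀ {k k′ m} → m ≤ k → m ≤ k′ →
                               digitSumFuel k m ≡ digitSumFuel k′ m
digitSumFuel-fuel-irrelevant {k} {k′} {zero} _ _ = trans (digitSumFuel-zero k) (sym (digitSumFuel-zero k′))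
digitSumFuel-fuel-irrelevant {suc k} {suc k′} {m@(suc p)} (s≤s p≤k) (s≤s p≤k′) =
  cong (m % 2 +_) (digitSumFuel-fuel-irrelevant (halve≤ p≤k) (halve≤ p≤k′))
  where
  halve≤ : ∀ {j} → p ≤ j → m / 2 ≤ j
  halve≤ p≤j = ≤-pred (≤-trans (m/n<m m 2 (s≤s (s≤s z≤n))) (s≤s p≤j))

s-step : ∀ m → s m ≡ m % 2 + s (m / 2)
s-step zero        = refl
s-step m@(suc p)   = cong (m % 2 +_)
  (digitSumFuel-fuel-irrelevant (≤-pred (m/n<m m 2 (s≤s (s≤s z≤n)))) ≤-refl)

s-bit+*2 : ∀ r a → r < 2 → s (r + a * 2) ≡ r + s a
s-bit+*2 r a r<2 = begin
  s (r + a * 2)                    ≡⟨ s-step (r + a * 2) ⟩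
  (r + a * 2) % 2 + s ((r + a * 2) / 2)
    ≡⟨ cong₂ (λ x y → x + s y) (trans ([m+kn]%n≡m%n r a 2) (m<n⇒m%n≡m r<2)) quotient ⟩
  r + s a                          ∎
  where
  open ≡-Reasoning
  quotient : (r + a * 2) / 2 ≡ a
  quotient = trans (+-distrib-/-∣ʳ r (divides-refl a))
                   (cong₂ _+_ (m<n⇒m/n≡0 r<2) (m*n/n≡m a 2))

s-*2^+ : ∀ j x b → b < 2 ^ j → s (x * 2 ^ j + b) ≡ s x + s b
s-*2^+ zero x (suc b) (s≤s ())
s-*2^+ zero x zero _ = begin
  s (x * 1 + 0) ≡⟨ cong s (trans (+-identityʳ _) (*-identityʳ x)) ⟩
  s x           ≡⟨ +-identityʳ (s x) ⟨
  s x + 0       ∎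
  where open ≡-Reasoning
s-*2^+ (suc j) x b b<2^1+j = begin
  s (x * 2 ^ suc j + b)                ≡⟨ cong s split ⟩
  s (b % 2 + (x * 2 ^ j + b / 2) * 2)  ≡⟨ s-bit+*2 (b % 2) (x * 2 ^ j + b / 2) (m%n<n b 2) ⟩
  b % 2 + s (x * 2 ^ j + b / 2)        ≡⟨ cong (b % 2 +_) (s-*2^+ j x (b / 2) b/2<2^j) ⟩
  b % 2 + (s x + s (b / 2))            ≡⟨ rearrange (b % 2) (s x) (s (b / 2)) ⟩
  s x + (b % 2 + s (b / 2))            ≡⟨ cong (s x +_) (sym (s-step b)) ⟩
  s x + s b                            ∎
  where
  open ≡-Reasoning
  b/2<2^j : b / 2 < 2 ^ j
  b/2<2^j = m<n*o⇒m/o<n (subst (b <_) (*-comm 2 (2 ^ j)) b<2^1+j)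
  rearrange : ∀ a b c → a + (b + c) ≡ b + (a + c)
  rearrange = solve-∀
  split : x * 2 ^ suc j + b ≡ b % 2 + (x * 2 ^ j + b / 2) * 2
  split = trans (cong (x * 2 ^ suc j +_) (m≡m%n+[m/n]*n b 2))
                (regroup (b % 2) x (2 ^ j) (b / 2))
    where
    regroup : ∀ r x p q → x * (2 * p) + (r + q * 2) ≡ r + (x * p + q) * 2
    regroup = solve-∀

pushBit : ℕ → Bool → ℕ
pushBit acc b = 2 * acc + bitVal b

foldl-pushBit : ∀ acc w → foldl pushBit acc w ≡ acc * 2 ^ length w + value w
foldl-pushBit acc [] = sym (trans (+-identityʳ _) (*-identityʳ acc))
foldl-pushBit acc (c ∷ w) = begin
  foldl pushBit (pushBit acc c) w                       ≡⟨ foldl-pushBit (pushBit acc c) w ⟩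
  (2 * acc + bitVal c) * 2 ^ length w + value w         ≡⟨ regroup acc (bitVal c) (2 ^ length w) (value w) ⟩
  acc * (2 * 2 ^ length w) + (bitVal c * 2 ^ length w + value w)
    ≡⟨ cong (acc * 2 ^ length (c ∷ w) +_) (foldl-pushBit (bitVal c) w) ⟨
  acc * 2 ^ length (c ∷ w) + value (c ∷ w)              ∎
  where
  open ≡-Reasoning
  regroup : ∀ a b p v → (2 * a + b) * p + v ≡ a * (2 * p) + (b * p + v)
  regroup = solve-∀

2^length-word : ∀ ℓ → 2 ^ length (word ℓ) ≡ 4 * 4 ^ ℓ
2^length-word zero    = refl
2^length-word (suc ℓ) = trans (cong (λ p → 2 * (2 * p)) (2^length-word ℓ)) (regroup (4 ^ ℓ))
  where
  regroup : ∀ p → 2 * (2 * (4 * p)) ≡ 4 * (4 * p)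
  regroup = solve-∀

value-word-suc : ∀ ℓ → value (word (suc ℓ)) ≡ 8 * 4 ^ ℓ + value (word ℓ)
value-word-suc ℓ = begin
  value (word (suc ℓ))                     ≡⟨ foldl-pushBit 2 (word ℓ) ⟩
  2 * 2 ^ length (word ℓ) + value (word ℓ) ≡⟨ cong (λ p → 2 * p + value (word ℓ)) (2^length-word ℓ) ⟩
  2 * (4 * 4 ^ ℓ) + value (word ℓ)         ≡⟨ cong (_+ value (word ℓ)) (*-assoc 2 4 (4 ^ ℓ)) ⟨
  8 * 4 ^ ℓ + value (word ℓ)               ∎
  where open ≡-Reasoning

3*value-word : ∀ ℓ → 3 * value (word ℓ) ≡ 1 + 8 * 4 ^ ℓ
3*value-word zero    = refl
3*value-word (suc ℓ) = begin
  3 * value (word (suc ℓ))          ≡⟨ cong (3 *_) (value-word-suc ℓ) ⟩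
  3 * (8 * 4 ^ ℓ + value (word ℓ))  ≡⟨ *-distribˡ-+ 3 (8 * 4 ^ ℓ) (value (word ℓ)) ⟩
  3 * (8 * 4 ^ ℓ) + 3 * value (word ℓ) ≡⟨ cong (3 * (8 * 4 ^ ℓ) +_) (3*value-word ℓ) ⟩
  3 * (8 * 4 ^ ℓ) + (1 + 8 * 4 ^ ℓ) ≡⟨ regroup (4 ^ ℓ) ⟩
  1 + 8 * 4 ^ suc ℓ                 ∎
  where
  open ≡-Reasoning
  regroup : ∀ p → 3 * (8 * p) + (1 + 8 * p) ≡ 1 + 8 * (4 * p)
  regroup = solve-∀

4^≡1+3* : ∀ m → ∃ λ t → 4 ^ m ≡ 1 + 3 * t
4^≡1+3* zero = 0 , refl
4^≡1+3* (suc m) with 4^≡1+3* m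
... | t , 4^m≡ = 1 + 4 * t , trans (cong (4 *_) 4^m≡) (regroup t)
  where
  regroup : ∀ t → 4 * (1 + 3 * t) ≡ 1 + 3 * (1 + 4 * t)
  regroup = solve-∀

value-word-2+ : ∀ m t → 4 ^ m ≡ 1 + 3 * t → value (word (2 + m)) ≡ 43 + 128 * t
value-word-2+ m t 4^m≡ = *-cancelˡ-≡ _ _ 3 (begin
  3 * value (word (2 + m))      ≡⟨ 3*value-word (2 + m) ⟩
  1 + 8 * (4 * (4 * 4 ^ m))     ≡⟨ cong (λ p → 1 + 8 * (4 * (4 * p))) 4^m≡ ⟩
  1 + 8 * (4 * (4 * (1 + 3 * t))) ≡⟨ regroup t ⟩
  3 * (43 + 128 * t)            ∎)
  where
  open ≡-Reasoning
  regroup : ∀ t → 1 + 8 * (4 * (4 * (1 + 3 * t))) ≡ 3 * (43 + 128 * t)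
  regroup = solve-∀

2^[2+4m] : ∀ m → 2 ^ (2 + 4 * m) ≡ 4 * (4 ^ m * 4 ^ m)
2^[2+4m] m = begin
  2 ^ (2 + 4 * m)        ≡⟨ ^-distribˡ-+-* 2 2 (4 * m) ⟩
  4 * 2 ^ (4 * m)        ≡⟨ cong (λ k → 4 * 2 ^ k) (*-assoc 2 2 m) ⟩
  4 * 2 ^ (2 * (2 * m))  ≡⟨ cong (λ k → 4 * 2 ^ (2 * (m + k))) (+-identityʳ m) ⟩
  4 * 2 ^ (2 * (m + m))  ≡⟨ cong (4 *_) (^-*-assoc 2 2 (m + m)) ⟨
  4 * 4 ^ (m + m)        ≡⟨ cong (4 *_) (^-distribˡ-+-* 4 m m) ⟩
  4 * (4 ^ m * 4 ^ m)    ∎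
  where open ≡-Reasoning

square-decomposition : ∀ m → ∃₂ λ J b →
  b < 2 ^ J × value (word (2 + m)) * value (word (2 + m)) ≡ (7 * 2 ^ J + b) * 2 ^ 6 + 57
square-decomposition m with 4^≡1+3* m
... | t , 4^m≡ = 2 + 4 * m , 4 * t * t + 4 * t , b<2^J , n*n≡
  where
  open ≡-Reasoning
  2^J≡ : 2 ^ (2 + 4 * m) ≡ 4 * ((1 + 3 * t) * (1 + 3 * t))
  2^J≡ = trans (2^[2+4m] m) (cong (λ p → 4 * (p * p)) 4^m≡)
  gap : ∀ t → 4 * ((1 + 3 * t) * (1 + 3 * t)) ≡ suc ((4 * t * t + 4 * t) + (3 + 20 * t + 32 * t * t))
  gap = solve-∀
  b<2^J : 4 * t * t + 4 * t < 2 ^ (2 + 4 * m)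
  b<2^J = subst (4 * t * t + 4 * t <_) (sym (trans 2^J≡ (gap t))) (s≤s (m≤m+n _ _))
  square : ∀ t → (43 + 128 * t) * (43 + 128 * t)
               ≡ (7 * (4 * ((1 + 3 * t) * (1 + 3 * t))) + (4 * t * t + 4 * t)) * 2 ^ 6 + 57
  square = solve-∀
  n*n≡ : value (word (2 + m)) * value (word (2 + m))
       ≡ (7 * 2 ^ (2 + 4 * m) + (4 * t * t + 4 * t)) * 2 ^ 6 + 57
  n*n≡ = begin
    value (word (2 + m)) * value (word (2 + m))  ≡⟨ cong (λ n → n * n) (value-word-2+ m t 4^m≡) ⟩
    (43 + 128 * t) * (43 + 128 * t)              ≡⟨ square t ⟩
    (7 * (4 * ((1 + 3 * t) * (1 + 3 * t))) + (4 * t * t + 4 * t)) * 2 ^ 6 + 57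
      ≡⟨ cong (λ p → (7 * p + (4 * t * t + 4 * t)) * 2 ^ 6 + 57) 2^J≡ ⟨
    (7 * 2 ^ (2 + 4 * m) + (4 * t * t + 4 * t)) * 2 ^ 6 + 57 ∎

s[[7*2^J+b]*2^6+57] : ∀ J b → b < 2 ^ J → s ((7 * 2 ^ J + b) * 2 ^ 6 + 57) ≡ s b + 7
s[[7*2^J+b]*2^6+57] J b b<2^J = begin
  s ((7 * 2 ^ J + b) * 2 ^ 6 + 57)  ≡⟨ s-*2^+ 6 (7 * 2 ^ J + b) 57 (m≤m+n 58 6) ⟩
  s (7 * 2 ^ J + b) + 4             ≡⟨ cong (_+ 4) (s-*2^+ J 7 b b<2^J) ⟩
  3 + s b + 4                       ≡⟨ cong (_+ 4) (+-comm 3 (s b)) ⟩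
  s b + 3 + 4                       ≡⟨ +-assoc (s b) 3 4 ⟩
  s b + 7                           ∎
  where open ≡-Reasoning

lemma6 : (n ℓ : ℕ) → 2 ≤ ℓ → n ≡ value (word ℓ) → 7 ≤ s (n * n)
lemma6 n (suc (suc m)) (s≤s (s≤s _)) refl =
  let J , b , b<2^J , n*n≡ = square-decomposition m in
  begin
    7                                 ≤⟨ m≤n+m 7 (s b) ⟩
    s b + 7                           ≡⟨ s[[7*2^J+b]*2^6+57] J b b<2^J ⟨
    s ((7 * 2 ^ J + b) * 2 ^ 6 + 57)  ≡⟨ cong s n*n≡ ⟨
    s (n * n)                         ∎
  where open ≤-Reasoning
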